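{- Let $G$ be a finite unicyclic graph whose unique cycle has length $n$ (an induced cycle $C_n$). If $n\geqslant 7$ and $\gcd(n,3)=1$, then $D_3(G)$ is connected.
   Context: A unicyclic graph is a connected graph containing exactly one cycle. The $3$-distance graph $D_3(G)$ has vertex set $V(G)$, two vertices being adjacent iff their distance in $G$ is exactly $3$. -}

module Defs where

open import Data.Nat using (ℕ; zero; suc; _+_; _<_; _≤_; _≥_)
open import Data.Fin using (Fin)
open import Data.List using (List; []; _∷_; length)
open import Data.List.Relation.Unary.Unique.Propositional using (Unique)
open import Data.Product using (_×_; Σ; ∃; _,_)
open import Data.Sum using (_⊎_)
open import Data.Empty using (⊥)
open import Relation.Nullary using (¬_)
open import Relation.Binary.PropositionalEquality using (_≡_)
open import Level using (0ℓ; suc)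

record Graph (V : ℕ) : Set₁ where
  field
    Adj   : Fin V → Fin V → Set
    sym   : ∀ {x y} → Adj x y → Adj y x
    irrefl : ∀ {x} → ¬ Adj x x

data Walk {V : ℕ} (G : Graph V) : Fin V → Fin V → ℕ → Set where
  here : ∀ {x} → Walk G x x 0
  step : ∀ {x y z k} → Graph.Adj G x y → Walk G y z k → Walk G x z (Data.Nat.suc k)

Connected : ∀ {V} → Graph V → Set
Connected G = ∀ x y → ∃ λ k → Walk G x y k

Dist : ∀ {V} → Graph V → Fin V → Fin V → ℕ → Set
Dist G x y d = Walk G x y d × (∀ k → k < d → ¬ Walk G x y k)

D3 : ∀ {V} → Graph V → Graph V
D3 {V} G = record
  { Adj = λ x y → Dist G x y 3
  ; sym = λ {x} {y} → symD {x} {y}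
  ; irrefl = λ { (_ , min) → min 0 (s≤s' ) here }
  }
  where
  open import Data.Nat using (s≤s; z≤n)
  s≤s' : 0 < 3
  s≤s' = s≤s z≤n
  revW : ∀ {a b k} → Walk G a b k → Walk G b a (k + 0)
  revW = rev here
    where
    open import Data.Nat.Properties using (+-suc; +-identityʳ)
    open import Relation.Binary.PropositionalEquality using (subst; sym)
    rev : ∀ {a b c j k} → Walk G b a j → Walk G b c k → Walk G c a (k + j)
    rev acc here = acc
    rev {j = j} {k = suc k} acc (step e w) =
      subst (Walk G _ _) (+-suc k j) (rev (step (Graph.sym G e) acc) w)
  revW' : ∀ {a b k} → Walk G a b k → Walk G b a k
  revW' {k = k} w = Relation.Binary.PropositionalEquality.subst (Walk G _ _) (Data.Nat.Properties.+-identityʳ k) (revW w)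
    where import Data.Nat.Properties
          import Relation.Binary.PropositionalEquality
  symD : ∀ {x y} → Dist G x y 3 → Dist G y x 3
  symD (w , min) = revW' w , λ k k<3 w' → min k k<3 (revW' w')

data Path {V : ℕ} (G : Graph V) : Fin V → List (Fin V) → Fin V → Set where
  one  : ∀ {x} → Path G x (x ∷ []) x
  cons : ∀ {x y vs z} → Graph.Adj G x y → Path G y vs z → Path G x (x ∷ vs) z

record Cycle {V : ℕ} (G : Graph V) : Set where
  field
    first last : Fin V
    verts   : List (Fin V)
    path    : Path G first verts last
    closing : Graph.Adj G last first
    distinct : Unique verts
    long    : 3 ≤ length verts

cycleLength : ∀ {V} {G : Graph V} → Cycle G → ℕ
cycleLength c = length (Cycle.verts c)

data PathEdge {V : ℕ} {G : Graph V} : ∀ {x vs z} → Path G x vs z → Fin V → Fin V → Set where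
  edgeHere  : ∀ {x y vs z} (e : Graph.Adj G x y) (p : Path G y vs z) → PathEdge (cons e p) x y
  edgeThere : ∀ {x y vs z a b} (e : Graph.Adj G x y) {p : Path G y vs z} → PathEdge p a b → PathEdge (cons e p) a b

CycleEdge : ∀ {V} {G : Graph V} → Cycle G → Fin V → Fin V → Set
CycleEdge c a b =
  (PathEdge (Cycle.path c) a b ⊎ PathEdge (Cycle.path c) b a)
  ⊎ ((a ≡ Cycle.last c × b ≡ Cycle.first c) ⊎ (b ≡ Cycle.last c × a ≡ Cycle.first c))

-- Two cycles are the same subgraph iff they have the same edge set.
SameCycle : ∀ {V} {G : Graph V} → Cycle G → Cycle G → Set
SameCycle c d = ∀ a b → (CycleEdge c a b → CycleEdge d a b) × (CycleEdge d a b → CycleEdge c a b)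

Unicyclic : ∀ {V} → Graph V → Set
Unicyclic G = Connected G × Σ (Cycle _) λ c → ∀ (d : Cycle G) → SameCycle c d

theCycle : ∀ {V} {G : Graph V} → Unicyclic G → Cycle G
theCycle (_ , c , _) = c

-- Every cycle of G is C: a short cycle cannot pass through a vertex off C, and
-- one on vertices of C uses only edges of C.  This forces the distances used: along
-- C = a₀ a₁ … a_{n-1}, d(aᵢ, aᵢ₊₃) = 3 as soon as n ≥ 6; a vertex x ∉ C adjacent
-- to aᵢ has distance 3 from aᵢ₊₂, one at distance two from aᵢ has distance 3
-- from aᵢ₊₁, and one further out has distance 3 from the vertex three steps
-- along a walk towards C.  So every vertex is D₃-connected to C, on which D₃
-- moves by 3 steps; as gcd (n, 3) = 1, such moves reach every vertex of C.
module Submission where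

open import Data.Empty using (⊥; ⊥-elim)
open import Data.Fin using (Fin)
open import Data.Fin.Properties using (_≟_)
open import Data.List using (List; []; _∷_; _++_; _∷ʳ_; [_]; length)
open import Data.List.Properties using (++-assoc; ++-identityʳ; ∷-injectiveˡ)
open import Data.List.Membership.Propositional using (_∈_; _∉_)
open import Data.List.Membership.Propositional.Properties using (∈-∃++; ∈-++⁻)
import Data.List.Membership.DecPropositional as DecMembership
open import Data.List.Relation.Unary.All using ([]; _∷_)
open import Data.List.Relation.Unary.All.Properties using (All¬⇒¬Any)
open import Data.List.Relation.Unary.AllPairs using ([]; _∷_)
open import Data.List.Relation.Unary.Any using (here; there)
open import Data.List.Relation.Unary.Unique.Propositional using (Unique)
open import Data.List.Relation.Binary.Permutation.Propositional
  using (_↭_; ↭-refl; ↭-sym; ↭-trans; ↭⇒↭ₛ)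
open import Data.List.Relation.Binary.Permutation.Propositional.Properties
  using (++-comm; ∈-resp-↭; ↭-length)
import Data.List.Relation.Binary.Permutation.Setoid.Properties as ↭ₛ
open import Data.Nat using (ℕ; zero; suc; _+_; _*_; _≤_; _<_; s≤s; z≤n)
open import Data.Nat.GCD using (gcd; gcd-GCD; GCD; module Bézout)
open import Data.Nat.GeneralisedArithmetic using (iterate)
open import Data.Nat.Induction using (<-wellFounded)
open import Data.Nat.Properties using (<⇒≤; m<n+m)
open import Data.Product using (_×_; ∃; ∃₂; _,_; proj₂)
open import Data.Sum using (_⊎_; inj₁; inj₂)
import Data.Sum as Sum
open import Function using (_∘_)
open import Induction.WellFounded using (Acc; acc)
open import Relation.Nullary using (¬_; yes; no)
open import Relation.Binary.PropositionalEquality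
  using (_≡_; _≢_; refl; sym; trans; cong; subst; setoid; module ≡-Reasoning)
open import Defs

open Bézout.Identity using (+-; -+)

iterate-+ : ∀ {A : Set} (f : A → A) x m n → iterate f x (m + n) ≡ iterate f (iterate f x m) n
iterate-+ f x zero    n = refl
iterate-+ f x (suc m) n = iterate-+ f (f x) m n

data Consecutive {A : Set} : List A → A → A → Set where
  here  : ∀ {x y l} → Consecutive (x ∷ y ∷ l) x y
  there : ∀ {z l p q} → Consecutive l p q → Consecutive (z ∷ l) p q

module _ {A : Set} where

  closed : A → List A → List A
  closed a as = a ∷ (as ∷ʳ a)

  rotate : List A → List A
  rotate []       = []
  rotate (x ∷ xs) = xs ∷ʳ x

  consecutive-left∈ : ∀ {l} {p q : A} → Consecutive l p q → p ∈ l
  consecutive-left∈ here      = here refl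
  consecutive-left∈ (there h) = there (consecutive-left∈ h)

  consecutive-right∈ : ∀ {l} {p q : A} → Consecutive l p q → q ∈ l
  consecutive-right∈ here      = there (here refl)
  consecutive-right∈ (there h) = there (consecutive-right∈ h)

  ∈-closed⁻ : ∀ {z a : A} as → z ∈ closed a as → z ∈ a ∷ as
  ∈-closed⁻ as (here z≡a) = here z≡a
  ∈-closed⁻ as (there z∈) with ∈-++⁻ as z∈
  ... | inj₁ z∈as       = there z∈as
  ... | inj₂ (here z≡a) = here z≡a

  consecutive-++ : ∀ {l} {p q : A} r → Consecutive l p q → Consecutive (l ++ r) p q
  consecutive-++ r here      = here
  consecutive-++ r (there h) = there (consecutive-++ r h)

  consecutive-∷ʳ-last : ∀ {a b : A} l → Consecutive (l ∷ʳ a ∷ʳ b) a b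
  consecutive-∷ʳ-last []      = here
  consecutive-∷ʳ-last (x ∷ l) = there (consecutive-∷ʳ-last l)

  consecutive-∷ʳ⁻ : ∀ {a b p q : A} l → Consecutive (l ∷ʳ a ∷ʳ b) p q →
                    Consecutive (l ∷ʳ a) p q ⊎ (p ≡ a × q ≡ b)
  consecutive-∷ʳ⁻ []          here               = inj₂ (refl , refl)
  consecutive-∷ʳ⁻ []          (there (there ()))
  consecutive-∷ʳ⁻ (x ∷ [])    here               = inj₁ here
  consecutive-∷ʳ⁻ (x ∷ y ∷ l) here               = inj₁ here
  consecutive-∷ʳ⁻ (x ∷ l)     (there h)          = Sum.map₁ there (consecutive-∷ʳ⁻ l h)

  consecutive-∷ʳ-left∈ : ∀ {z p q : A} l → Consecutive (l ∷ʳ z) p q → p ∈ l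
  consecutive-∷ʳ-left∈ []          (there ())
  consecutive-∷ʳ-left∈ (x ∷ [])    here      = here refl
  consecutive-∷ʳ-left∈ (x ∷ y ∷ l) here      = here refl
  consecutive-∷ʳ-left∈ (x ∷ l)     (there h) = there (consecutive-∷ʳ-left∈ l h)

  consecutive-∷ʳ-functional : ∀ {z p q q′ : A} l → Unique l →
    Consecutive (l ∷ʳ z) p q → Consecutive (l ∷ʳ z) p q′ → q ≡ q′
  consecutive-∷ʳ-functional []          _          (there ()) _
  consecutive-∷ʳ-functional (x ∷ [])    _          here       here = refl
  consecutive-∷ʳ-functional (x ∷ [])    _          here       (there (there ()))
  consecutive-∷ʳ-functional (x ∷ [])    _          (there (there ())) _
  consecutive-∷ʳ-functional (x ∷ y ∷ l) _          here       here = refl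
  consecutive-∷ʳ-functional (x ∷ y ∷ l) (x∉ ∷ _)   here       (there h) =
    ⊥-elim (All¬⇒¬Any x∉ (consecutive-∷ʳ-left∈ (y ∷ l) h))
  consecutive-∷ʳ-functional (x ∷ y ∷ l) (x∉ ∷ _)   (there h)  here =
    ⊥-elim (All¬⇒¬Any x∉ (consecutive-∷ʳ-left∈ (y ∷ l) h))
  consecutive-∷ʳ-functional (x ∷ y ∷ l) (_ ∷ uniq) (there h)  (there h′) =
    consecutive-∷ʳ-functional (y ∷ l) uniq h h′

  consecutive-closed-rotate : ∀ {a b p q : A} bs →
    Consecutive (closed a (b ∷ bs)) p q → Consecutive (closed b (bs ∷ʳ a)) p q
  consecutive-closed-rotate {b = b} bs here = consecutive-∷ʳ-last (b ∷ bs)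
  consecutive-closed-rotate bs (there h) = consecutive-++ _ h

  consecutive-closed-rotate⁻ : ∀ {a b p q : A} bs →
    Consecutive (closed b (bs ∷ʳ a)) p q → Consecutive (closed a (b ∷ bs)) p q
  consecutive-closed-rotate⁻ {b = b} bs h =
    Sum.[ there , (λ { (refl , refl) → here }) ] (consecutive-∷ʳ⁻ (b ∷ bs) h)

  rotate-↭ : ∀ l → rotate l ↭ l
  rotate-↭ []       = ↭-refl
  rotate-↭ (x ∷ xs) = ++-comm xs [ x ]

  rotate-++ : ∀ xs ys → iterate rotate (xs ++ ys) (length xs) ≡ ys ++ xs
  rotate-++ []       ys = sym (++-identityʳ ys)
  rotate-++ (x ∷ xs) ys = begin
    iterate rotate ((xs ++ ys) ∷ʳ x) (length xs)
      ≡⟨ cong (λ l → iterate rotate l (length xs)) (++-assoc xs ys [ x ]) ⟩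
    iterate rotate (xs ++ (ys ∷ʳ x)) (length xs) ≡⟨ rotate-++ xs (ys ∷ʳ x) ⟩
    ys ∷ʳ x ++ xs                                 ≡⟨ ++-assoc ys [ x ] xs ⟩
    ys ++ x ∷ xs                                  ∎
    where open ≡-Reasoning

  rotate-length : ∀ l → iterate rotate l (length l) ≡ l
  rotate-length l = begin
    iterate rotate l (length l)
      ≡⟨ cong (λ l′ → iterate rotate l′ (length l)) (sym (++-identityʳ l)) ⟩
    iterate rotate (l ++ []) (length l) ≡⟨ rotate-++ l [] ⟩
    l                                  ∎
    where open ≡-Reasoning

  rotate-period : ∀ k l → iterate rotate l (k * length l) ≡ l
  rotate-period zero    l = refl
  rotate-period (suc k) l = begin
    iterate rotate l (length l + k * length l)                  ≡⟨ iterate-+ rotate l (length l) (k * length l) ⟩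
    iterate rotate (iterate rotate l (length l)) (k * length l)
      ≡⟨ cong (λ l′ → iterate rotate l′ (k * length l)) (rotate-length l) ⟩
    iterate rotate l (k * length l)                             ≡⟨ rotate-period k l ⟩
    l                                                           ∎
    where open ≡-Reasoning

  rotate-to : ∀ {z : A} {l} → z ∈ l → ∃₂ λ k zs → iterate rotate l k ≡ z ∷ zs
  rotate-to {z} z∈ with xs , ys , refl ← ∈-∃++ z∈ = length xs , ys ++ xs , rotate-++ xs (z ∷ ys)

Reachable : ∀ {V} → Graph V → Fin V → Fin V → Set
Reachable H x y = ∃ (Walk H x y)

module _ {V : ℕ} {H : Graph V} where
  open Graph H using (Adj; irrefl) renaming (sym to Adj-sym)

  walk-∷ʳ : ∀ {a b c k} → Walk H a b k → Adj b c → Walk H a c (suc k)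
  walk-∷ʳ here        bc = step bc here
  walk-∷ʳ (step ab w) bc = step ab (walk-∷ʳ w bc)

  walk-reverse : ∀ {a b k} → Walk H a b k → Walk H b a k
  walk-reverse here        = here
  walk-reverse (step ab w) = walk-∷ʳ (walk-reverse w) (Adj-sym ab)

  walk-++ : ∀ {a b c k j} → Walk H a b k → Walk H b c j → Walk H a c (k + j)
  walk-++ here        w′ = w′
  walk-++ (step ab w) w′ = step ab (walk-++ w w′)

  reachable-sym : ∀ {a b} → Reachable H a b → Reachable H b a
  reachable-sym (k , w) = k , walk-reverse w

  reachable-trans : ∀ {a b c} → Reachable H a b → Reachable H b c → Reachable H a c
  reachable-trans (k , w) (j , w′) = k + j , walk-++ w w′

module GraphLemmas {V : ℕ} (H : Graph V) where
  open Graph H using (Adj; irrefl) renaming (sym to Adj-sym)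

  adj⇒≢ : ∀ {a b} → Adj a b → a ≢ b
  adj⇒≢ ab refl = irrefl ab

  dist3-intro : ∀ {x p q y} → Adj x p → Adj p q → Adj q y →
                x ≢ y → ¬ Adj x y → (∀ m → Adj x m → ¬ Adj m y) → Dist H x y 3
  dist3-intro xp pq qy x≢y x≁y no-middle = step xp (step pq (step qy here)) , shorter
    where
    shorter : ∀ k → k < 3 → ¬ Walk H _ _ k
    shorter 0 _ here                        = x≢y refl
    shorter 1 _ (step xy here)              = x≁y xy
    shorter 2 _ (step xm (step my here))    = no-middle _ xm my
    shorter (suc (suc (suc _))) (s≤s (s≤s (s≤s ()))) _

  path-consecutive-adj : ∀ {f vs l z p q} → Path H f vs l → Adj l z →
                         Consecutive (vs ∷ʳ z) p q → Adj p q
  path-consecutive-adj one                 lz here               = lz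
  path-consecutive-adj one                 lz (there (there ()))
  path-consecutive-adj (cons e one)        lz here               = e
  path-consecutive-adj (cons e (cons _ _)) lz here               = e
  path-consecutive-adj (cons e p)          lz (there h)          = path-consecutive-adj p lz h

  pathEdge-consecutive : ∀ {f vs l a b} {p : Path H f vs l} → PathEdge p a b → Consecutive vs a b
  pathEdge-consecutive (edgeHere e one)        = here
  pathEdge-consecutive (edgeHere e (cons _ _)) = here
  pathEdge-consecutive (edgeThere e pe)        = there (pathEdge-consecutive pe)

  path-last-consecutive : ∀ {f vs l z} → Path H f vs l → Consecutive (vs ∷ʳ z) l z
  path-last-consecutive one        = here
  path-last-consecutive (cons e p) = there (path-last-consecutive p)

  cycleEdge-consecutive : ∀ (d : Cycle H) {a b} → CycleEdge d a b →
    let open Cycle d in Consecutive (verts ∷ʳ first) a b ⊎ Consecutive (verts ∷ʳ first) b a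
  cycleEdge-consecutive d (inj₁ (inj₁ pe))          = inj₁ (consecutive-++ _ (pathEdge-consecutive pe))
  cycleEdge-consecutive d (inj₁ (inj₂ pe))          = inj₂ (consecutive-++ _ (pathEdge-consecutive pe))
  cycleEdge-consecutive d (inj₂ (inj₁ (refl , refl))) = inj₁ (path-last-consecutive (Cycle.path d))
  cycleEdge-consecutive d (inj₂ (inj₂ (refl , refl))) = inj₂ (path-last-consecutive (Cycle.path d))

  closing-edge : ∀ (d : Cycle H) → CycleEdge d (Cycle.last d) (Cycle.first d)
  closing-edge d = inj₂ (inj₁ (refl , refl))

  pathCycle : ∀ {f vs l} → Path H f vs l → Adj l f → Unique vs → 3 ≤ length vs → Cycle H
  pathCycle p lf uniq long = record
    { first = _ ; last = _ ; verts = _ ; path = p ; closing = lf ; distinct = uniq ; long = long }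

  triangle : ∀ {a b c} → Adj a b → Adj b c → Adj c a → Cycle H
  triangle ab bc ca = pathCycle (cons ab (cons bc one)) ca
    ((adj⇒≢ ab ∷ adj⇒≢ (Adj-sym ca) ∷ []) ∷ (adj⇒≢ bc ∷ []) ∷ [] ∷ [])
    (s≤s (s≤s (s≤s z≤n)))

  square : ∀ {a b c d} → Adj a b → Adj b c → Adj c d → Adj d a → a ≢ c → b ≢ d → Cycle H
  square ab bc cd da a≢c b≢d = pathCycle (cons ab (cons bc (cons cd one))) da
    ((adj⇒≢ ab ∷ a≢c ∷ adj⇒≢ (Adj-sym da) ∷ []) ∷ (adj⇒≢ bc ∷ b≢d ∷ [])
      ∷ (adj⇒≢ cd ∷ []) ∷ [] ∷ [])
    (s≤s (s≤s (s≤s z≤n)))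

  pentagon : ∀ {a b c d e} → Adj a b → Adj b c → Adj c d → Adj d e → Adj e a →
             a ≢ c → a ≢ d → b ≢ d → b ≢ e → c ≢ e → Cycle H
  pentagon ab bc cd de ea a≢c a≢d b≢d b≢e c≢e = pathCycle (cons ab (cons bc (cons cd (cons de one)))) ea
    ((adj⇒≢ ab ∷ a≢c ∷ a≢d ∷ adj⇒≢ (Adj-sym ea) ∷ []) ∷ (adj⇒≢ bc ∷ b≢d ∷ b≢e ∷ [])
      ∷ (adj⇒≢ cd ∷ c≢e ∷ []) ∷ (adj⇒≢ de ∷ []) ∷ [] ∷ [])
    (s≤s (s≤s (s≤s z≤n)))

module UniqueCycle {V : ℕ} (G : Graph V) (c : Cycle G) (only : ∀ d → SameCycle c d) where
  open Graph G using (Adj) renaming (sym to Adj-sym)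
  open GraphLemmas G
  open DecMembership (_≟_ {V}) using (_∈?_)

  C : List (Fin V)
  C = Cycle.verts c

  n : ℕ
  n = cycleLength c

  _⇝_ : Fin V → Fin V → Set
  _⇝_ = Reachable (D3 G)

  dist3⇒⇝ : ∀ {x y} → Dist G x y 3 → x ⇝ y
  dist3⇒⇝ d = 1 , step d here

  record Arrangement : Set where
    constructor arrangement
    field
      start : Fin V
      rest  : List (Fin V)
      adjacent : ∀ {p q} → Consecutive (closed start rest) p q → Adj p q
      edge-consecutive : ∀ {p q} → CycleEdge c p q →
        Consecutive (closed start rest) p q ⊎ Consecutive (closed start rest) q p
      ↭C : start ∷ rest ↭ C

    vertices : List (Fin V)
    vertices = start ∷ rest

  open Arrangement

  around : Arrangement → List (Fin V)
  around o = closed (start o) (rest o)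

  module _ (o : Arrangement) where

    ∈C : ∀ {z} → z ∈ vertices o → z ∈ C
    ∈C = ∈-resp-↭ (↭C o)

    start∈C : start o ∈ C
    start∈C = ∈C (here refl)

    vertices-unique : Unique (vertices o)
    vertices-unique = ↭ₛ.Unique-resp-↭ (setoid (Fin V)) (↭⇒↭ₛ (↭-sym (↭C o))) (Cycle.distinct c)

    length-vertices : length (vertices o) ≡ n
    length-vertices = ↭-length (↭C o)

    successor-unique : ∀ {p q q′} → Consecutive (around o) p q → Consecutive (around o) p q′ → q ≡ q′
    successor-unique = consecutive-∷ʳ-functional (vertices o) vertices-unique

    cycle-consecutive : ∀ (d : Cycle G) {p q} → CycleEdge d p q →
                        Consecutive (around o) p q ⊎ Consecutive (around o) q p
    cycle-consecutive d {p} {q} e = edge-consecutive o (proj₂ (only d p q) e)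

    -- A cycle through three consecutive vertices p q r is C itself, so its
    -- closing edge r p must also be consecutive around C.
    no-chord : ∀ {p q r s} → Consecutive (around o) p q → Consecutive (around o) q r →
               Consecutive (around o) r s → p ≢ s → ¬ Adj p r
    no-chord pq qr rs p≢s pr with cycle-consecutive pqr (closing-edge pqr)
      where pqr = triangle (adjacent o pq) (adjacent o qr) (Adj-sym pr)
    ... | inj₁ rp  = p≢s (successor-unique rp rs)
    ... | inj₂ pr′ = adj⇒≢ (adjacent o qr) (successor-unique pq pr′)

  fromPath : ∀ {f vs l} → Path G f vs l → Adj l f →
    (∀ {p q} → CycleEdge c p q → Consecutive (vs ∷ʳ f) p q ⊎ Consecutive (vs ∷ʳ f) q p) →
    vs ↭ C → Arrangement
  fromPath p@one        lf edges π = arrangement _ [] (path-consecutive-adj p lf) edges π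
  fromPath p@(cons _ _) lf edges π = arrangement _ _  (path-consecutive-adj p lf) edges π

  initial : Arrangement
  initial = fromPath (Cycle.path c) (Cycle.closing c) (cycleEdge-consecutive c) ↭-refl

  advance : Arrangement → Arrangement
  advance o@(arrangement a [] _ _ _) = o
  advance (arrangement a (b ∷ bs) adj edges π) = arrangement b (bs ∷ʳ a)
    (λ h → adj (consecutive-closed-rotate⁻ bs h))
    (λ e → Sum.map (consecutive-closed-rotate bs) (consecutive-closed-rotate bs) (edges e))
    (↭-trans (rotate-↭ (a ∷ b ∷ bs)) π)

  vertices-advance : ∀ o → vertices (advance o) ≡ rotate (vertices o)
  vertices-advance (arrangement a []      _ _ _) = refl
  vertices-advance (arrangement a (_ ∷ _) _ _ _) = refl

  vertices-iterate : ∀ k o → vertices (iterate advance o k) ≡ iterate rotate (vertices o) k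
  vertices-iterate zero    o = refl
  vertices-iterate (suc k) o =
    trans (vertices-iterate k (advance o)) (cong (λ l → iterate rotate l k) (vertices-advance o))

  advance-period : ∀ k o → start (iterate advance o (k * n)) ≡ start o
  advance-period k o = ∷-injectiveˡ (begin
    vertices (iterate advance o (k * n))               ≡⟨ vertices-iterate (k * n) o ⟩
    iterate rotate (vertices o) (k * n)
      ≡⟨ cong (λ m → iterate rotate (vertices o) (k * m)) (sym (length-vertices o)) ⟩
    iterate rotate (vertices o) (k * length (vertices o)) ≡⟨ rotate-period k (vertices o) ⟩
    vertices o                                         ∎)
    where open ≡-Reasoning

  advance-to : ∀ {z} → z ∈ C → ∃ λ k → start (iterate advance initial k) ≡ z
  advance-to z∈C with k , zs , eq ← rotate-to (∈-resp-↭ (↭-sym (↭C initial)) z∈C) =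
    k , ∷-injectiveˡ (trans (vertices-iterate k initial) eq)

  cycle-first∈C : ∀ (d : Cycle G) → Cycle.first d ∈ C
  cycle-first∈C d with cycle-consecutive initial d (closing-edge d)
  ... | inj₁ h = ∈C initial (∈-closed⁻ _ (consecutive-right∈ h))
  ... | inj₂ h = ∈C initial (∈-closed⁻ _ (consecutive-left∈ h))

  ∉C⇒≢ : ∀ {x y} → x ∉ C → y ∈ C → x ≢ y
  ∉C⇒≢ x∉C y∈C refl = x∉C y∈C

  off-cycle-no-triangle : ∀ {x a b} → x ∉ C → Adj x a → Adj a b → ¬ Adj x b
  off-cycle-no-triangle x∉C xa ab xb = x∉C (cycle-first∈C (triangle xa ab (Adj-sym xb)))

  dist3-off-cycle : ∀ {x p q y} → x ∉ C → Adj x p → Adj p q → Adj q y →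
                    x ≢ q → x ≢ y → p ≢ y → ¬ Adj p y → Dist G x y 3
  dist3-off-cycle {x} {p} {q} {y} x∉C xp pq qy x≢q x≢y p≢y p≁y = dist3-intro xp pq qy x≢y x≁y no-middle
    where
    x≁y : ¬ Adj x y
    x≁y xy = x∉C (cycle-first∈C (square xp pq qy (Adj-sym xy) x≢q p≢y))
    no-middle : ∀ m → Adj x m → ¬ Adj m y
    no-middle m xm my with m ≟ p | m ≟ q
    ... | yes refl | _        = p≁y my
    ... | no _     | yes refl = off-cycle-no-triangle x∉C xp pq xm
    ... | no m≢p   | no m≢q   =
      x∉C (cycle-first∈C
        (pentagon xp pq qy (Adj-sym my) (Adj-sym xm) x≢q x≢y p≢y (m≢p ∘ sym) (m≢q ∘ sym)))

  base : Fin V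
  base = start initial

  data WalkToCycle : Fin V → ℕ → Set where
    arrive : ∀ {x} → x ∈ C → WalkToCycle x 0
    move   : ∀ {x y k} → x ∉ C → Adj x y → WalkToCycle y k → WalkToCycle x (suc k)

  walkToCycle : ∀ {x z k} → Walk G x z k → z ∈ C → ∃ (WalkToCycle x)
  walkToCycle here         z∈C = 0 , arrive z∈C
  walkToCycle {x} (step xy w) z∈C with x ∈? C
  ... | yes x∈C = 0 , arrive x∈C
  ... | no x∉C  = let k , w′ = walkToCycle w z∈C in suc k , move x∉C xy w′

  data FiveOrMore : List (Fin V) → Set where
    fiveOrMore : ∀ {a₁ a₂ a₃ a₄ a₅ as} → FiveOrMore (a₁ ∷ a₂ ∷ a₃ ∷ a₄ ∷ a₅ ∷ as)

  module _ (6≤n : 6 ≤ n) where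

    rest-fiveOrMore : ∀ o → FiveOrMore (rest o)
    rest-fiveOrMore o with rest o | subst (6 ≤_) (sym (length-vertices o)) 6≤n
    ... | _ ∷ _ ∷ _ ∷ _ ∷ _ ∷ _ | _ = fiveOrMore
    ... | []                    | s≤s ()
    ... | _ ∷ []                | s≤s (s≤s ())
    ... | _ ∷ _ ∷ []            | s≤s (s≤s (s≤s ()))
    ... | _ ∷ _ ∷ _ ∷ []        | s≤s (s≤s (s≤s (s≤s ())))
    ... | _ ∷ _ ∷ _ ∷ _ ∷ []    | s≤s (s≤s (s≤s (s≤s (s≤s ()))))

    dist-advance³ : ∀ o → Dist G (start o) (start (iterate advance o 3)) 3
    dist-advance³ o@(arrangement a₀ _ adj _ _) with rest-fiveOrMore o | vertices-unique o
    ... | fiveOrMore {a₁} {a₂} {a₃} {a₄} {a₅}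
        | (_ ∷ a₀≢a₂ ∷ a₀≢a₃ ∷ a₀≢a₄ ∷ a₀≢a₅ ∷ _) ∷ (_ ∷ a₁≢a₃ ∷ a₁≢a₄ ∷ _) ∷ _ =
      dist3-intro (adj c₀₁) (adj c₁₂) (adj c₂₃) a₀≢a₃ a₀≁a₃ no-middle
      where
      c₀₁ : Consecutive (around o) a₀ a₁
      c₀₁ = here
      c₁₂ : Consecutive (around o) a₁ a₂
      c₁₂ = there here
      c₂₃ : Consecutive (around o) a₂ a₃
      c₂₃ = there (there here)
      c₃₄ : Consecutive (around o) a₃ a₄
      c₃₄ = there (there (there here))
      c₄₅ : Consecutive (around o) a₄ a₅
      c₄₅ = there (there (there (there here)))
      a₀≁a₃ : ¬ Adj a₀ a₃
      a₀≁a₃ a₀a₃ with cycle-consecutive o a₀₁₂₃ (closing-edge a₀₁₂₃)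
        where a₀₁₂₃ = square (adj c₀₁) (adj c₁₂) (adj c₂₃) (Adj-sym a₀a₃) a₀≢a₂ a₁≢a₃
      ... | inj₁ c₃₀ = a₀≢a₄ (successor-unique o c₃₀ c₃₄)
      ... | inj₂ c₀₃ = a₁≢a₃ (successor-unique o c₀₁ c₀₃)
      no-middle : ∀ m → Adj a₀ m → ¬ Adj m a₃
      no-middle m a₀m ma₃ with m ≟ a₁ | m ≟ a₂
      ... | yes refl | _        = no-chord o c₁₂ c₂₃ c₃₄ a₁≢a₄ ma₃
      ... | no _     | yes refl = no-chord o c₀₁ c₁₂ c₂₃ a₀≢a₃ a₀m
      ... | no m≢a₁  | no m≢a₂  =
        Sum.[ not-before-a₀ (cycle-consecutive o pent a₃m)
            , (λ c₀ₘ → m≢a₁ (sym (successor-unique o c₀₁ c₀ₘ))) ]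
          (cycle-consecutive o pent (closing-edge pent))
        where
        pent : Cycle G
        pent = pentagon (adj c₀₁) (adj c₁₂) (adj c₂₃) (Adj-sym ma₃) (Adj-sym a₀m)
                        a₀≢a₂ a₀≢a₃ a₁≢a₃ (m≢a₁ ∘ sym) (m≢a₂ ∘ sym)
        a₃m : CycleEdge pent a₃ m
        a₃m = inj₁ (inj₁ (edgeThere _ (edgeThere _ (edgeThere _ (edgeHere _ one)))))
        not-before-a₀ : Consecutive (around o) a₃ m ⊎ Consecutive (around o) m a₃ → ¬ Consecutive (around o) m a₀
        not-before-a₀ (inj₁ c₃ₘ) cₘ₀ with refl ← successor-unique o c₃₄ c₃ₘ =
          a₀≢a₅ (successor-unique o cₘ₀ c₄₅)
        not-before-a₀ (inj₂ cₘ₃) cₘ₀ = a₀≢a₃ (successor-unique o cₘ₀ cₘ₃)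

    pendant-dist : ∀ o {x} → x ∉ C → Adj x (start o) → Dist G x (start (iterate advance o 2)) 3
    pendant-dist o@(arrangement _ _ adj _ _) x∉C xa₀ with rest-fiveOrMore o | vertices-unique o
    ... | fiveOrMore | (_ ∷ a₀≢a₂ ∷ a₀≢a₃ ∷ _) ∷ _ =
      dist3-off-cycle x∉C xa₀ (adj here) (adj (there here))
        (∉C⇒≢ x∉C (start∈C (advance o))) (∉C⇒≢ x∉C (start∈C (iterate advance o 2))) a₀≢a₂
        (no-chord o here (there here) (there (there here)) a₀≢a₃)

    pendant₂-dist : ∀ o {x p} → x ∉ C → p ∉ C → Adj x p → Adj p (start o) →
                    Dist G x (start (advance o)) 3
    pendant₂-dist o@(arrangement _ _ adj _ _) x∉C p∉C xp pa₀ with rest-fiveOrMore o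
    ... | fiveOrMore =
      dist3-off-cycle x∉C xp pa₀ (adj here)
        (∉C⇒≢ x∉C (start∈C o)) (∉C⇒≢ x∉C (start∈C (advance o)))
        (∉C⇒≢ p∉C (start∈C (advance o)))
        (off-cycle-no-triangle p∉C pa₀ (adj here))

    advance³ᵏ⇝ : ∀ k o → start o ⇝ start (iterate advance o (k * 3))
    advance³ᵏ⇝ zero    o = 0 , here
    advance³ᵏ⇝ (suc k) o =
      reachable-trans (dist3⇒⇝ (dist-advance³ o)) (advance³ᵏ⇝ k (iterate advance o 3))

    module _ (coprime : gcd n 3 ≡ 1) where

      advance⇝ : ∀ o → start o ⇝ start (advance o)
      advance⇝ o with Bézout.identity (subst (GCD n 3) coprime (gcd-GCD n 3))
      ... | -+ k j 1+kn≡3j = subst (start o ⇝_) (begin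
        start (iterate advance o (j * 3))           ≡⟨ cong (start ∘ iterate advance o) (sym 1+kn≡3j) ⟩
        start (iterate advance (advance o) (k * n)) ≡⟨ advance-period k (advance o) ⟩
        start (advance o)                           ∎) (advance³ᵏ⇝ j o)
        where open ≡-Reasoning
      ... | +- k j 1+3j≡kn = reachable-sym (subst (start (advance o) ⇝_) (begin
        start (iterate advance (advance o) (j * 3)) ≡⟨ cong (start ∘ iterate advance o) 1+3j≡kn ⟩
        start (iterate advance o (k * n))           ≡⟨ advance-period k o ⟩
        start o                                     ∎) (advance³ᵏ⇝ j (advance o)))
        where open ≡-Reasoning

      advanceᵏ⇝ : ∀ k o → start o ⇝ start (iterate advance o k)
      advanceᵏ⇝ zero    o = 0 , here
      advanceᵏ⇝ (suc k) o = reachable-trans (advance⇝ o) (advanceᵏ⇝ k (advance o))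

      on-cycle⇝base : ∀ {z} → z ∈ C → z ⇝ base
      on-cycle⇝base z∈C with k , refl ← advance-to z∈C = reachable-sym (advanceᵏ⇝ k initial)

      pendant⇝base : ∀ o {x} → x ∉ C → Adj x (start o) → x ⇝ base
      pendant⇝base o x∉C xa =
        reachable-trans (dist3⇒⇝ (pendant-dist o x∉C xa)) (on-cycle⇝base (start∈C (iterate advance o 2)))

      pendant₂⇝base : ∀ o {x p} → x ∉ C → p ∉ C → Adj x p → Adj p (start o) → x ⇝ base
      pendant₂⇝base o x∉C p∉C xp pa =
        reachable-trans (dist3⇒⇝ (pendant₂-dist o x∉C p∉C xp pa)) (on-cycle⇝base (start∈C (advance o)))

      walkToCycle⇝base : ∀ {k x} → Acc _<_ k → WalkToCycle x k → x ⇝ base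
      walkToCycle⇝base _ (arrive x∈C) = on-cycle⇝base x∈C
      walkToCycle⇝base _ (move x∉C xa (arrive a∈C)) with i , refl ← advance-to a∈C =
        pendant⇝base (iterate advance initial i) x∉C xa
      walkToCycle⇝base _ (move x∉C xp (move p∉C pa (arrive a∈C))) with i , refl ← advance-to a∈C =
        pendant₂⇝base (iterate advance initial i) x∉C p∉C xp pa
      walkToCycle⇝base {x = x} (acc shorter)
        (move {y = p} x∉C xp (move {y = q} p∉C pq (move {y = y} {k} q∉C qy w)))
        with x ≟ q | x ≟ y | p ≟ y
      -- a repeated vertex among x, p, q, y shortens the walk
      ... | yes refl | _        | _        =
        walkToCycle⇝base (shorter (m<n+m (suc k) {2} (s≤s z≤n))) (move q∉C qy w)
      ... | no _     | yes refl | _        = walkToCycle⇝base (shorter (m<n+m k {3} (s≤s z≤n))) w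
      ... | no _     | no _     | yes refl =
        walkToCycle⇝base (shorter (m<n+m (suc k) {2} (s≤s z≤n))) (move x∉C xp w)
      ... | no x≢q   | no x≢y   | no p≢y   = reachable-trans
        (dist3⇒⇝ (dist3-off-cycle x∉C xp pq qy x≢q x≢y p≢y (off-cycle-no-triangle p∉C pq qy)))
        (walkToCycle⇝base (shorter (m<n+m k {3} (s≤s z≤n))) w)

      connected⇒⇝base : Connected G → ∀ x → x ⇝ base
      connected⇒⇝base connected x =
        let k , w = walkToCycle (proj₂ (connected x base)) (start∈C initial)
        in  walkToCycle⇝base (<-wellFounded k) w

theorem2p8 : ∀ {V : ℕ} (G : Graph V) (U : Unicyclic G)
    → 7 ≤ cycleLength (theCycle U)
    → gcd (cycleLength (theCycle U)) 3 ≡ 1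
    → Connected (D3 G)
theorem2p8 G (connected , c , only) 7≤n coprime x y = reachable-trans (⇝base x) (reachable-sym (⇝base y))
  where
  open UniqueCycle G c only
  ⇝base : ∀ z → z ⇝ base
  ⇝base = connected⇒⇝base (<⇒≤ 7≤n) coprime connected
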